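{- For any $\mathbb{N}$-formula $\varphi$ in normal form and any forcing condition $p$, there is a forcing condition $q\supseteq p$ such that $q\Vdash_\mathcal{A}\varphi$ or $q\Vdash_\mathcal{A}neg(\varphi)$.
   Context: Let $\tau$ be a countable relational vocabulary with $=,\neq$ and $\mathcal{A}$ a $\tau$-structure with universe $\omega$. Fix an effective enumeration $(\phi^{at}_n)$ of atomic $\tau$-formulas with free variables of $\phi^{at}_n$ among $x_0,\dots,x_n$. $\mathbb{N}$-formulas in normal form: built from atoms $\top,\bot,D(\mathbf n)$ without quantifiers; $\mathbb{N}$-$\Sigma^p_0$ = finite conjunctions of atoms; $\mathbb{N}$-$\Pi^p_0$ = finite disjunctions of negated atoms; $\mathbb{N}$-$\Sigma^p_1$/$\mathbb{N}$-$\Pi^p_1$ = countable disjunctions of $\mathbb{N}$-$\Sigma^p_0$ / conjunctions of $\mathbb{N}$-$\Pi^p_0$; for $\alpha\ge2$, $\mathbb{N}$-$\Sigma^p_\alpha$ = $\bigvee_i(\phi_i\wedge\theta_i)$ and $\mathbb{N}$-$\Pi^p_\alpha$ = $\bigwedge_i(\phi_i\vee\theta_i)$, $\phi_i\in\mathbb{N}$-$\Sigma^p_{\beta_i}$, $\theta_i\in\mathbb{N}$-$\Pi^p_{\beta_i}$, $0<\beta_i<\alpha$. $neg(\varphi)$ swaps each atom with its negation and $\bigvee\leftrightarrow\bigwedge$, $\wedge\leftrightarrow\vee$ (recursively), mapping $\mathbb{N}$-$\Sigma^p_\alpha$ to $\mathbb{N}$-$\Pi^p_\alpha$ and vice versa.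 Forcing conditions: finite tuples $p=(p_0,\dots,p_{k-1})$ of distinct natural numbers, ordered by extension $\subseteq$. Forcing $\Vdash_\mathcal{A}$: $p\Vdash\top$, $p\not\Vdash\bot$; $p\Vdash D(\mathbf n)$ iff all variables $x_i$ of $\phi^{at}_n$ satisfy $i<k$ and $\mathcal{A}\models\phi^{at}_n[x_i\mapsto p_i]$; a finite conjunction of atoms is forced iff each conjunct is; an $\mathbb{N}$-$\Sigma^p_1$ formula $\bigvee_i\phi_i$ is forced iff some $\phi_i$ is; an $\mathbb{N}$-$\Sigma^p_\alpha$ ($\alpha\ge2$) formula $\bigvee_i(\phi_i\wedge\theta_i)$ is forced iff for some $i$ both $\phi_i$ and $\theta_i$ are forced; an $\mathbb{N}$-$\Pi^p_\alpha$ formula $\varphi$ ($\alpha\ge0$) is forced by $p$ iff no $q\supseteq p$ forces $neg(\varphi)$. -}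

module Defs where

open import Data.Nat using (ℕ; zero; suc; _<_; _≤_)
open import Data.Fin using (Fin)
open import Data.List using (List; []; _∷_; _++_; length; lookup)
open import Data.List.Relation.Unary.All using (All)
open import Data.List.Relation.Unary.Unique.Propositional using (Unique)
open import Data.Vec using (Vec; toList) renaming (map to vmap)
open import Data.Product using (Σ; _×_; _,_; proj₁; ∃-syntax)
open import Data.Unit using (⊤)
open import Data.Empty using (⊥)
open import Relation.Binary.PropositionalEquality using (_≡_; _≢_)
open import Relation.Nullary using (¬_)

data Idx : Set where
  finite : ℕ → Idx
  omega  : Idx

El : Idx → Set
El (finite n) = Fin n
El omega      = ℕ

-- A countable relational vocabulary τ (with = and ≠ built in)

record Vocabulary : Set₁ where
  field
    symbols : Idx
    arity   : El symbols → ℕ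
open Vocabulary public

-- atomic τ-formulas over the variables x₀, x₁, … (variables are indices)
data AtomicFormula (τ : Vocabulary) : Set where
  rel : (R : El (symbols τ)) → Vec ℕ (arity τ R) → AtomicFormula τ
  eq  : ℕ → ℕ → AtomicFormula τ
  neq : ℕ → ℕ → AtomicFormula τ

vars : {τ : Vocabulary} → AtomicFormula τ → List ℕ
vars (rel R xs) = toList xs
vars (eq i j)   = i ∷ j ∷ []
vars (neq i j)  = i ∷ j ∷ []

-- a τ-structure with universe ω = ℕ
record Structure (τ : Vocabulary) : Set₁ where
  field
    interp : (R : El (symbols τ)) → Vec ℕ (arity τ R) → Set
open Structure public

Sat : {τ : Vocabulary} → Structure τ → (ℕ → ℕ) → AtomicFormula τ → Set
Sat 𝒜 s (rel R xs) = interp 𝒜 R (vmap s xs)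
Sat 𝒜 s (eq i j)   = s i ≡ s j
Sat 𝒜 s (neq i j)  = s i ≢ s j

record AtomEnumeration (τ : Vocabulary) : Set where
  field
    φat        : ℕ → AtomicFormula τ
    varsBound  : ∀ n → All (_≤ n) (vars (φat n))
    surjective : ∀ (ψ : AtomicFormula τ) → ∃[ n ] (φat n ≡ ψ)
open AtomEnumeration public

Condition : Set
Condition = Σ (List ℕ) Unique

tuple : Condition → List ℕ
tuple = proj₁

-- p ⊑ q : q extends p (p is an initial segment of q), i.e. q ⊇ p
_⊑_ : Condition → Condition → Set
p ⊑ q = ∃[ r ] (tuple q ≡ tuple p ++ r)

-- assignment x_i ↦ p_i (the default value 0 for i ≥ k is never used,
-- since forcing of D(n) requires all variables to satisfy i < k)
assign : Condition → ℕ → ℕ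
assign p i = go (tuple p) i
  where
  go : List ℕ → ℕ → ℕ
  go []       _       = 0
  go (x ∷ xs) zero    = x
  go (x ∷ xs) (suc i) = go xs i

-- Countable ordinals as Brouwer trees, with the (well-founded) subtree order

data Ord : Set where
  oz : Ord
  os : Ord → Ord
  ol : (ℕ → Ord) → Ord

data _<ₒ_ : Ord → Ord → Set where
  <-here  : ∀ {x} → x <ₒ os x
  <-there : ∀ {x y} → x <ₒ y → x <ₒ os y
  <-lim   : ∀ {x f} (n : ℕ) → x <ₒ f n → x <ₒ ol f

data NAtom : Set where
  ⊤ᵃ ⊥ᵃ : NAtom
  D     : ℕ → NAtom

data Pol : Set where
  sig pi : Pol

flip : Pol → Pol
flip sig = pi
flip pi  = sig

-- Shape α: the common skeleton of a Σ^p_α formula and its negation.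
--  * lit0 as          : Σ^p_0 = ⋀ as            /  Π^p_0 = ⋁ ¬as
--  * lit1 I f         : Σ^p_1 = ⋁_{i∈I} Σ(f i)   /  Π^p_1 = ⋀_{i∈I} Π(f i)
--  * hi I β _ _ φ θ   : Σ^p_α = ⋁_i (Σ(φ i) ∧ Π(θ i))
--                       Π^p_α = ⋀_i (Π(φ i) ∨ Σ(θ i))
--    with 0 < β i < α, φ i, θ i of level β i.
data Shape : Ord → Set where
  lit0 : List NAtom → Shape oz
  lit1 : (I : Idx) → (El I → Shape oz) → Shape (os oz)
  hi   : ∀ {α} (I : Idx) (β : El I → Ord) →
         (∀ i → oz <ₒ β i) → (∀ i → β i <ₒ α) →
         ((i : El I) → Shape (β i)) → ((i : El I) → Shape (β i)) → Shape α

Formula : Ord → Set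
Formula α = Pol × Shape α

neg : ∀ {α} → Formula α → Formula α
neg (k , s) = (flip k , s)

module Forcing {τ : Vocabulary} (𝒜 : Structure τ) (e : AtomEnumeration τ) where

  ForcesAtom : Condition → NAtom → Set
  ForcesAtom p ⊤ᵃ    = ⊤
  ForcesAtom p ⊥ᵃ    = ⊥
  ForcesAtom p (D n) = All (_< length (tuple p)) (vars (φat e n))
                     × Sat 𝒜 (assign p) (φat e n)

  mutual
    ForcesΣ : ∀ {α} → Condition → Shape α → Set
    ForcesΣ p (lit0 as)        = All (ForcesAtom p) as
    ForcesΣ p (lit1 I f)       = Σ (El I) λ i → ForcesΣ p (f i)
    ForcesΣ p (hi I β _ _ φ θ) = Σ (El I) λ i → ForcesΣ p (φ i) × ForcesΠ p (θ i)

    -- a Π formula is forced iff no extension forces its negation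
    -- (the negation of the Π formula with shape s is the Σ formula with shape s)
    ForcesΠ : ∀ {α} → Condition → Shape α → Set
    ForcesΠ p s = ∀ q → p ⊑ q → ¬ ForcesΣ q s

  _⊩_ : ∀ {α} → Condition → Formula α → Set
  p ⊩ (sig , s) = ForcesΣ p s
  p ⊩ (pi  , s) = ForcesΠ p s

{-# OPTIONS --safe #-}
-- Classically, either some extension of p forces the Σ-formula with shape s,
-- or none does; in the latter case p forces the Π-formula with shape s by the
-- very definition of forcing for Π-formulas. Since φ and neg φ are the Σ- and
-- Π-formulas of one shape, one of them is forced by p or by an extension of p.
module Submission where

open import Defs
open import Axiom.ExcludedMiddle using (ExcludedMiddle)
open import Level using (0ℓ)
open import Data.Product using (∃-syntax; _×_; _,_)
open import Data.Sum using (_⊎_; inj₁; inj₂)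
open import Data.List using ([])
open import Data.List.Properties using (++-identityʳ)
open import Relation.Binary.PropositionalEquality using (sym)
open import Relation.Nullary using (yes; no)

⊑-refl : ∀ p → p ⊑ p
⊑-refl (xs , _) = [] , sym (++-identityʳ xs)

module _ (em : ExcludedMiddle 0ℓ) {τ : Vocabulary} (𝒜 : Structure τ) (e : AtomEnumeration τ) where
  open Forcing 𝒜 e

  ForcesΣ-above⊎ForcesΠ : ∀ {α} (s : Shape α) (p : Condition) →
                          ∃[ q ] (p ⊑ q × ForcesΣ q s) ⊎ ForcesΠ p s
  ForcesΣ-above⊎ForcesΠ s p with em {∃[ q ] (p ⊑ q × ForcesΣ q s)}
  ... | yes forcedAbove = inj₁ forcedAbove
  ... | no ¬forcedAbove = inj₂ λ q p⊑q q⊩s → ¬forcedAbove (q , p⊑q , q⊩s)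

mainTheorem8 : ExcludedMiddle 0ℓ →
    {τ : Vocabulary} (𝒜 : Structure τ) (e : AtomEnumeration τ) →
    ∀ {α} (φ : Formula α) (p : Condition) →
    ∃[ q ] (p ⊑ q × (Forcing._⊩_ 𝒜 e q φ ⊎ Forcing._⊩_ 𝒜 e q (neg φ)))
mainTheorem8 em 𝒜 e (sig , s) p with ForcesΣ-above⊎ForcesΠ em 𝒜 e s p
... | inj₁ (q , p⊑q , q⊩φ) = q , p⊑q , inj₁ q⊩φ
... | inj₂ p⊩negφ          = p , ⊑-refl p , inj₂ p⊩negφ
mainTheorem8 em 𝒜 e (pi , s) p with ForcesΣ-above⊎ForcesΠ em 𝒜 e s p
... | inj₁ (q , p⊑q , q⊩negφ) = q , p⊑q , inj₂ q⊩negφ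
... | inj₂ p⊩φ                = p , ⊑-refl p , inj₁ p⊩φ
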